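{- Let $p \geq 1$ and let $G$ be a bipartite connected $2p$-regular graph. Then $\mathcal{M}_5(G)$ is a nut graph.
   Context: $\mathcal{M}_5(G)$ is the graph obtained from $G$ by fusing a bouquet of $p$ pentagons to every vertex of $G$: for each vertex $v$ of $G$ and each of $p$ copies, add four new vertices $a,b,c,d$ with edges $va, ab, bc, cd, dv$ (so they form a $5$-cycle through $v$; all new vertices distinct). A nut graph is a simple connected graph whose adjacency matrix has one-dimensional kernel spanned by a vector with no zero entry. -}

module Defs where

open import Data.Nat using (ℕ; zero; suc; _+_; _*_; _<_)
open import Data.Bool using (Bool; true; false; if_then_else_; _∧_; _∨_; T)
open import Data.Fin using (Fin; zero; suc; toℕ; splitAt; remQuot)
import Data.Fin as F
open import Data.Sum using (_⊎_; inj₁; inj₂)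
open import Data.Product using (_×_; _,_; Σ; ∃)
open import Relation.Binary.PropositionalEquality using (_≡_; _≢_)
open import Relation.Nullary.Decidable using (⌊_⌋)
open import Data.Rational using (ℚ; 0ℚ)
import Data.Rational as Q
import Data.Nat as N

AdjMat : ℕ → Set
AdjMat n = Fin n → Fin n → Bool

Simple : ∀ {n} → AdjMat n → Set
Simple {n} A = (∀ i j → A i j ≡ A j i) × (∀ i → A i i ≡ false)

data Walk {n} (A : AdjMat n) : Fin n → Fin n → Set where
  here : ∀ {i} → Walk A i i
  step : ∀ {i j k} → T (A i j) → Walk A j k → Walk A i k

Connected : ∀ {n} → AdjMat n → Set
Connected {n} A = (0 < n) × (∀ i j → Walk A i j)

Σℕ : ∀ n → (Fin n → ℕ) → ℕ
Σℕ zero    f = 0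
Σℕ (suc n) f = f zero + Σℕ n (λ i → f (suc i))

Σℚ : ∀ n → (Fin n → ℚ) → ℚ
Σℚ zero    f = 0ℚ
Σℚ (suc n) f = f zero Q.+ Σℚ n (λ i → f (suc i))

degree : ∀ {n} → AdjMat n → Fin n → ℕ
degree {n} A i = Σℕ n (λ j → if A i j then 1 else 0)

Regular : ∀ {n} → ℕ → AdjMat n → Set
Regular {n} k A = ∀ i → degree A i ≡ k

Bipartite : ∀ {n} → AdjMat n → Set
Bipartite {n} A = Σ (Fin n → Bool) λ c → ∀ i j → T (A i j) → c i ≢ c j

mulVec : ∀ {n} → AdjMat n → (Fin n → ℚ) → Fin n → ℚ
mulVec {n} A x i = Σℚ n (λ j → if A i j then x j else 0ℚ)

InKernel : ∀ {n} → AdjMat n → (Fin n → ℚ) → Set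
InKernel {n} A x = ∀ i → mulVec A x i ≡ 0ℚ

IsNut : ∀ {n} → AdjMat n → Set
IsNut {n} A =
  Simple A × Connected A ×
  Σ (Fin n → ℚ) λ x →
    InKernel A x × (∀ i → x i ≢ 0ℚ) ×
    (∀ y → InKernel A y → Σ ℚ λ t → ∀ i → y i ≡ t Q.* x i)

-- Vertices of M5(G): Fin (n + n * (p * 4)).
-- The first n are the vertices of G; the rest encode triples (v , c , k)
-- = k-th new vertex (k = 0..3 for a,b,c,d) of the c-th pentagon at v.
data M5Vert (n p : ℕ) : Set where
  old : Fin n → M5Vert n p
  new : Fin n → Fin p → Fin 4 → M5Vert n p

decode : ∀ n p → Fin (n + n * (p * 4)) → M5Vert n p
decode n p i with splitAt n i
... | inj₁ v = old v
... | inj₂ w with remQuot {n} (p * 4) w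
...   | v , r with remQuot {p} 4 r
...     | c , k = new v c k

eqF : ∀ {m} → Fin m → Fin m → Bool
eqF i j = ⌊ i F.≟ j ⌋

eqN : ℕ → ℕ → Bool
eqN a b = ⌊ a N.≟ b ⌋

-- k is an end of the path a-b-c-d (attached to v)
isEnd : Fin 4 → Bool
isEnd k = eqN (toℕ k) 0 ∨ eqN (toℕ k) 3

adjV : ∀ {n p} → AdjMat n → M5Vert n p → M5Vert n p → Bool
adjV A (old u)     (old v)       = A u v
adjV A (old u)     (new v c k)   = eqF u v ∧ isEnd k
adjV A (new v c k) (old u)       = eqF u v ∧ isEnd k
adjV A (new v c k) (new v' c' k') =
  eqF v v' ∧ eqF c c' ∧ (eqN (suc (toℕ k)) (toℕ k') ∨ eqN (suc (toℕ k')) (toℕ k))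

M5 : ∀ {n} (p : ℕ) → AdjMat n → AdjMat (n + n * (p * 4))
M5 {n} p A i j = adjV A (decode n p i) (decode n p j)

{-# OPTIONS --safe #-}
module Submission where

-- Let σ be the ±1 vector of the bipartition of G. Extending a function f on G along every pentagon
-- v a b c d at v by (f v, −f v, −f v, f v) makes the rows of all pentagon vertices vanish, while the
-- row of v becomes (A f)(v) + 2p f(v). Since σ is an eigenvector of A for −2p, its extension is a
-- kernel vector with no zero entry. Conversely, the pentagon rows force every kernel vector to be the
-- extension of its restriction f to G, and then A f = −2p f. Hence σf satisfies A(σf) = 2p σf, and by
-- the maximum principle on the connected 2p-regular graph G (at a maximum of σf every neighbour attains
-- the maximum as well) σf is constant, i.e. f is a multiple of σ.

open import Defs
open import Data.Bool using (Bool; true; false; if_then_else_; _∧_; _∨_; T)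
open import Data.Bool.Properties using (∨-comm; T-∧)
open import Data.Fin using (Fin; zero; suc; toℕ; combine; remQuot; splitAt; _↑ˡ_; _↑ʳ_)
open import Data.Fin.Patterns using (0F; 1F; 2F; 3F)
import Data.Fin as Fin
import Data.Fin.Properties as Finₚ
open import Data.List using (allFin)
open import Data.List.Membership.Propositional.Properties using (∈-allFin)
open import Data.List.Relation.Unary.All using (lookup)
open import Data.Nat using (ℕ; zero; suc)
import Data.Nat as ℕ
import Data.Nat.Properties as ℕₚ
open import Data.Product using (Σ; _×_; _,_; proj₁; proj₂; uncurry)
open import Data.Rational using (ℚ; 0ℚ; 1ℚ; _+_; _*_; -_; _-_; _≤_)
import Data.Rational.Properties as ℚₚ
open import Data.Rational.Solver using (module +-*-Solver)
open import Data.Sum using (inj₁; inj₂)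
open import Data.Unit using (tt)
open import Function using (id; _∘_; Equivalence)
open import Relation.Binary.PropositionalEquality
open import Relation.Nullary using (contradiction)
open import Relation.Nullary.Decidable using (yes; no; isYes≗does; dec-true; dec-false; ⌊⌋-map′)

open import Algebra.Properties.Group ℚₚ.+-0-group
  using (inverseˡ-unique; inverseʳ-unique; identityˡ-unique; ⁻¹-involutive; x∙y⁻¹≈ε⇒x≈y)
open import Relation.Binary.Bundles using (DecTotalOrder)
open import Data.List.Extrema (DecTotalOrder.totalOrder ℚₚ.≤-decTotalOrder) using (argmax; f[xs]≤f[argmax])
open +-*-Solver using (solve; _:=_; _:+_; _:*_; _:-_; :-_; con)

fromℕ : ℕ → ℚ
fromℕ zero    = 0ℚ
fromℕ (suc k) = 1ℚ + fromℕ k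

fromℕ-+ : ∀ a b → fromℕ (a ℕ.+ b) ≡ fromℕ a + fromℕ b
fromℕ-+ zero    b = sym (ℚₚ.+-identityˡ (fromℕ b))
fromℕ-+ (suc a) b = trans (cong (1ℚ +_) (fromℕ-+ a b)) (sym (ℚₚ.+-assoc 1ℚ (fromℕ a) (fromℕ b)))

fromℕ-suc-* : ∀ k c → c + fromℕ k * c ≡ fromℕ (suc k) * c
fromℕ-suc-* k = solve 2 (λ k c → c :+ k :* c := (con 1ℚ :+ k) :* c) refl (fromℕ k)

fromℕ-double : ∀ a → fromℕ (2 ℕ.* a) ≡ fromℕ a + fromℕ a
fromℕ-double a = trans (cong (fromℕ ∘ (a ℕ.+_)) (ℕₚ.+-identityʳ a)) (fromℕ-+ a a)

if-cong : ∀ b {x y : ℚ} → (T b → x ≡ y) → (if b then x else 0ℚ) ≡ (if b then y else 0ℚ)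
if-cong true  x≡y = x≡y tt
if-cong false _   = refl

if-T : ∀ {b} → T b → ∀ (x y : ℚ) → (if b then x else y) ≡ x
if-T {true} _ _ _ = refl

if-∧ : ∀ a b (x : ℚ) → (if a ∧ b then x else 0ℚ) ≡ (if a then (if b then x else 0ℚ) else 0ℚ)
if-∧ true  _ _ = refl
if-∧ false _ _ = refl

eqF-refl : ∀ {m} (i : Fin m) → eqF i i ≡ true
eqF-refl i = trans (isYes≗does (i Fin.≟ i)) (dec-true (i Fin.≟ i) refl)

eqF-sym : ∀ {m} (i j : Fin m) → eqF i j ≡ eqF j i
eqF-sym i j with i Fin.≟ j
... | yes refl = sym (eqF-refl i)
... | no i≢j   = sym (trans (isYes≗does (j Fin.≟ i)) (dec-false (j Fin.≟ i) (i≢j ∘ sym)))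

T-eqF-refl : ∀ {m} (i : Fin m) → T (eqF i i)
T-eqF-refl i = subst T (sym (eqF-refl i)) tt

eqN-suc : ∀ m → eqN (suc m) m ≡ false
eqN-suc m = trans (isYes≗does (suc m ℕ.≟ m)) (dec-false (suc m ℕ.≟ m) ℕₚ.1+n≢n)

eqF-suc : ∀ {m} (i j : Fin m) → eqF (suc i) (suc j) ≡ eqF i j
eqF-suc i j = ⌊⌋-map′ (cong suc) Finₚ.suc-injective (i Fin.≟ j)

Σℚ-cong : ∀ n {f g : Fin n → ℚ} → (∀ i → f i ≡ g i) → Σℚ n f ≡ Σℚ n g
Σℚ-cong zero    _   = refl
Σℚ-cong (suc n) f≡g = cong₂ _+_ (f≡g zero) (Σℚ-cong n (f≡g ∘ suc))

Σℚ-0 : ∀ n → Σℚ n (λ _ → 0ℚ) ≡ 0ℚ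
Σℚ-0 zero    = refl
Σℚ-0 (suc n) = trans (cong (0ℚ +_) (Σℚ-0 n)) (ℚₚ.+-identityˡ 0ℚ)

Σℚ-+ : ∀ n (f g : Fin n → ℚ) → Σℚ n (λ i → f i + g i) ≡ Σℚ n f + Σℚ n g
Σℚ-+ zero    _ _ = refl
Σℚ-+ (suc n) f g = trans (cong (f zero + g zero +_) (Σℚ-+ n (f ∘ suc) (g ∘ suc)))
  (solve 4 (λ a b c d → (a :+ b) :+ (c :+ d) := (a :+ c) :+ (b :+ d)) refl
    (f zero) (g zero) (Σℚ n (f ∘ suc)) (Σℚ n (g ∘ suc)))

Σℚ-*ˡ : ∀ n c (f : Fin n → ℚ) → Σℚ n (λ i → c * f i) ≡ c * Σℚ n f
Σℚ-*ˡ zero    c _ = sym (ℚₚ.*-zeroʳ c)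
Σℚ-*ˡ (suc n) c f = trans (cong (c * f zero +_) (Σℚ-*ˡ n c (f ∘ suc)))
  (sym (ℚₚ.*-distribˡ-+ c (f zero) (Σℚ n (f ∘ suc))))

Σℚ-const : ∀ n c → Σℚ n (λ _ → c) ≡ fromℕ n * c
Σℚ-const zero    c = sym (ℚₚ.*-zeroˡ c)
Σℚ-const (suc n) c = trans (cong (c +_) (Σℚ-const n c)) (fromℕ-suc-* n c)

Σℚ-count : ∀ n (b : Fin n → Bool) c →
  Σℚ n (λ i → if b i then c else 0ℚ) ≡ fromℕ (Σℕ n (λ i → if b i then 1 else 0)) * c
Σℚ-count zero    _ c = sym (ℚₚ.*-zeroˡ c)
Σℚ-count (suc n) b c with b zero
... | true  = trans (cong (c +_) (Σℚ-count n (b ∘ suc) c))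
  (fromℕ-suc-* (Σℕ n (λ i → if b (suc i) then 1 else 0)) c)
... | false = trans (ℚₚ.+-identityˡ _) (Σℚ-count n (b ∘ suc) c)

Σℚ-if-∧ : ∀ m e (b : Fin m → Bool) (g : Fin m → ℚ) →
  Σℚ m (λ i → if e ∧ b i then g i else 0ℚ) ≡ (if e then Σℚ m (λ i → if b i then g i else 0ℚ) else 0ℚ)
Σℚ-if-∧ m true  _ _ = refl
Σℚ-if-∧ m false _ _ = Σℚ-0 m

Σℚ²-if-∧ : ∀ m k e (b : Fin m → Fin k → Bool) (g : Fin m → Fin k → ℚ) →
  Σℚ m (λ i → Σℚ k (λ j → if e ∧ b i j then g i j else 0ℚ)) ≡
  (if e then Σℚ m (λ i → Σℚ k (λ j → if b i j then g i j else 0ℚ)) else 0ℚ)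
Σℚ²-if-∧ m k true  _ _ = refl
Σℚ²-if-∧ m k false _ _ = trans (Σℚ-cong m (λ _ → Σℚ-0 k)) (Σℚ-0 m)

Σℚ-δ : ∀ n (i : Fin n) (f : Fin n → ℚ) → Σℚ n (λ j → if eqF i j then f j else 0ℚ) ≡ f i
Σℚ-δ (suc n) zero    f = trans (cong (f zero +_) (Σℚ-0 n)) (ℚₚ.+-identityʳ (f zero))
Σℚ-δ (suc n) (suc i) f = trans (ℚₚ.+-identityˡ _) (trans
  (Σℚ-cong n (λ j → cong (λ b → if b then f (suc j) else 0ℚ) (eqF-suc i j)))
  (Σℚ-δ n i (f ∘ suc)))

Σℚ-↑ : ∀ n m (f : Fin (n ℕ.+ m) → ℚ) → Σℚ (n ℕ.+ m) f ≡ Σℚ n (λ i → f (i ↑ˡ m)) + Σℚ m (λ j → f (n ↑ʳ j))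
Σℚ-↑ zero    m f = sym (ℚₚ.+-identityˡ _)
Σℚ-↑ (suc n) m f = trans (cong (f zero +_) (Σℚ-↑ n m (f ∘ suc))) (sym (ℚₚ.+-assoc (f zero) _ _))

Σℚ-combine : ∀ n k (f : Fin (n ℕ.* k) → ℚ) → Σℚ (n ℕ.* k) f ≡ Σℚ n (λ i → Σℚ k (λ j → f (combine i j)))
Σℚ-combine zero    k f = refl
Σℚ-combine (suc n) k f = trans (Σℚ-↑ k (n ℕ.* k) f) (cong (Σℚ k (λ j → f (j ↑ˡ (n ℕ.* k))) +_) (Σℚ-combine n k _))

Σℚ-nonneg : ∀ n (f : Fin n → ℚ) → (∀ i → 0ℚ ≤ f i) → 0ℚ ≤ Σℚ n f
Σℚ-nonneg zero    _ _  = ℚₚ.≤-refl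
Σℚ-nonneg (suc n) f 0≤f = subst (_≤ Σℚ (suc n) f) (ℚₚ.+-identityˡ 0ℚ)
  (ℚₚ.+-mono-≤ (0≤f zero) (Σℚ-nonneg n (f ∘ suc) (0≤f ∘ suc)))

Σℚ-nonneg-≡0 : ∀ n (f : Fin n → ℚ) → (∀ i → 0ℚ ≤ f i) → Σℚ n f ≡ 0ℚ → ∀ i → f i ≡ 0ℚ
Σℚ-nonneg-≡0 zero    _ _   _    ()
Σℚ-nonneg-≡0 (suc n) f 0≤f Σf≡0 = λ { zero → f0≡0 ; (suc i) → Σℚ-nonneg-≡0 n (f ∘ suc) (0≤f ∘ suc) rest≡0 i }
  where
  rest : ℚ
  rest = Σℚ n (f ∘ suc)
  f0≡0 : f zero ≡ 0ℚ
  f0≡0 = ℚₚ.≤-antisym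
    (subst₂ _≤_ (ℚₚ.+-identityʳ (f zero)) Σf≡0 (ℚₚ.+-monoʳ-≤ (f zero) (Σℚ-nonneg n (f ∘ suc) (0≤f ∘ suc))))
    (0≤f zero)
  rest≡0 : rest ≡ 0ℚ
  rest≡0 = trans (sym (ℚₚ.+-identityˡ rest)) (trans (cong (_+ rest) (sym f0≡0)) Σf≡0)

infixr 5 _++ʷ_

_++ʷ_ : ∀ {n} {A : AdjMat n} {i j k} → Walk A i j → Walk A j k → Walk A i k
here     ++ʷ w′ = w′
step e w ++ʷ w′ = step e (w ++ʷ w′)

reverseʷ : ∀ {n} {A : AdjMat n} → (∀ i j → A i j ≡ A j i) → ∀ {i j} → Walk A i j → Walk A j i
reverseʷ sym-A here               = here
reverseʷ sym-A (step {i} {j} e w) = reverseʷ sym-A w ++ʷ step (subst T (sym-A i j) e) here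

Eigen : ∀ {n} → AdjMat n → ℚ → (Fin n → ℚ) → Set
Eigen A μ f = ∀ v → mulVec A f v ≡ μ * f v

module _ {n} {A : AdjMat n} where

  mulVec-cong : ∀ {f g u} → (∀ w → T (A u w) → f w ≡ g w) → mulVec A f u ≡ mulVec A g u
  mulVec-cong {u = u} f≡g = Σℚ-cong n (λ w → if-cong (A u w) (f≡g w))

  mulVec-+ : ∀ f g u → mulVec A (λ w → f w + g w) u ≡ mulVec A f u + mulVec A g u
  mulVec-+ f g u = trans (Σℚ-cong n (λ w → if-+ (A u w) (f w) (g w))) (Σℚ-+ n _ _)
    where
    if-+ : ∀ b x y → (if b then x + y else 0ℚ) ≡ (if b then x else 0ℚ) + (if b then y else 0ℚ)
    if-+ true  _ _ = refl
    if-+ false _ _ = sym (ℚₚ.+-identityˡ 0ℚ)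

  mulVec-*ˡ : ∀ c f u → mulVec A (λ w → c * f w) u ≡ c * mulVec A f u
  mulVec-*ˡ c f u = trans (Σℚ-cong n (λ w → if-* (A u w) (f w))) (Σℚ-*ˡ n c _)
    where
    if-* : ∀ b x → (if b then c * x else 0ℚ) ≡ c * (if b then x else 0ℚ)
    if-* true  _ = refl
    if-* false _ = sym (ℚₚ.*-zeroʳ c)

  mulVec-const : ∀ {d} → Regular d A → ∀ c u → mulVec A (λ _ → c) u ≡ fromℕ d * c
  mulVec-const reg c u = trans (Σℚ-count n (A u) c) (cong (λ d → fromℕ d * c) (reg u))

  max-spreads : ∀ {d z M u w} → Regular d A → Eigen A (fromℕ d) z → (∀ v → z v ≤ M) →
                z u ≡ M → T (A u w) → z w ≡ M
  max-spreads {d} {z} {M} {u} {w} reg eig z≤M zu≡M uw =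
    sym (x∙y⁻¹≈ε⇒x≈y M (z w) (trans (sym (if-T uw _ 0ℚ)) (Σℚ-nonneg-≡0 n gap gap≥0 Σgap≡0 w)))
    where
    minus-plus : ∀ x → M - x + x ≡ M
    minus-plus = solve 2 (λ m x → (m :- x) :+ x := m) refl M
    gap : Fin n → ℚ
    gap v = if A u v then M - z v else 0ℚ
    gap≥0 : ∀ v → 0ℚ ≤ gap v
    gap≥0 v with A u v
    ... | true  = subst (_≤ M - z v) (ℚₚ.+-inverseʳ (z v)) (ℚₚ.+-monoˡ-≤ (- z v) (z≤M v))
    ... | false = ℚₚ.≤-refl
    open ≡-Reasoning
    Σgap≡0 : Σℚ n gap ≡ 0ℚ
    Σgap≡0 = identityˡ-unique (Σℚ n gap) (fromℕ d * M) (begin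
      mulVec A (λ v → M - z v) u + fromℕ d * M  ≡⟨ cong (mulVec A (λ v → M - z v) u +_)
                                                     (trans (cong (fromℕ d *_) (sym zu≡M)) (sym (eig u))) ⟩
      mulVec A (λ v → M - z v) u + mulVec A z u ≡⟨ sym (mulVec-+ (λ v → M - z v) z u) ⟩
      mulVec A (λ v → M - z v + z v) u          ≡⟨ mulVec-cong (λ v _ → minus-plus (z v)) ⟩
      mulVec A (λ _ → M) u                      ≡⟨ mulVec-const reg M u ⟩
      fromℕ d * M                               ∎)

  eigen-degree-constant : ∀ {d z} → Connected A → Regular d A → Eigen A (fromℕ d) z → ∀ u v → z u ≡ z v
  eigen-degree-constant {z = z} (_ , walk) reg eig u v = trans (attains u) (sym (attains v))
    where
    top : Fin n
    top = argmax z u (allFin n)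
    z≤top : ∀ w → z w ≤ z top
    z≤top w = lookup (f[xs]≤f[argmax] {f = z} u (allFin n)) (∈-allFin w)
    spread : ∀ {i j} → Walk A i j → z i ≡ z top → z j ≡ z top
    spread here       = id
    spread (step e w) = spread w ∘ λ zi≡top → max-spreads reg eig z≤top zi≡top e
    attains : ∀ w → z w ≡ z top
    attains w = spread (walk top w) refl

  sign : Bipartite A → Fin n → ℚ
  sign (col , _) v = if col v then 1ℚ else - 1ℚ

  sign-adj : ∀ bip {u w} → T (A u w) → sign bip w ≡ - sign bip u
  sign-adj (col , proper) {u} {w} e with col u in cu | col w in cw
  ... | true  | false = refl
  ... | false | true  = refl
  ... | true  | true  = contradiction (trans cu (sym cw)) (proper u w e)
  ... | false | false = contradiction (trans cu (sym cw)) (proper u w e)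

  sign*sign : ∀ bip v → sign bip v * sign bip v ≡ 1ℚ
  sign*sign (col , _) v with col v
  ... | true  = refl
  ... | false = refl

  sign≢0 : ∀ bip v → sign bip v ≢ 0ℚ
  sign≢0 (col , _) v with col v
  ... | true  = λ ()
  ... | false = λ ()

  sign-eigen : ∀ {d} (bip : Bipartite A) → Regular d A → Eigen A (- fromℕ d) (sign bip)
  sign-eigen {d} bip reg u = begin
    mulVec A (sign bip) u             ≡⟨ mulVec-cong (λ _ → sign-adj bip) ⟩
    mulVec A (λ _ → - sign bip u) u   ≡⟨ mulVec-const reg (- sign bip u) u ⟩
    fromℕ d * - sign bip u            ≡⟨ sym (ℚₚ.neg-distribʳ-* (fromℕ d) (sign bip u)) ⟩
    - (fromℕ d * sign bip u)          ≡⟨ ℚₚ.neg-distribˡ-* (fromℕ d) (sign bip u) ⟩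
    - fromℕ d * sign bip u            ∎
    where open ≡-Reasoning

  sign-flip : ∀ {μ f} (bip : Bipartite A) → Eigen A μ f → Eigen A (- μ) (λ v → sign bip v * f v)
  sign-flip {μ} {f} bip eig u = begin
    mulVec A (λ w → sign bip w * f w) u    ≡⟨ mulVec-cong (λ w e → cong (_* f w) (sign-adj bip e)) ⟩
    mulVec A (λ w → - sign bip u * f w) u  ≡⟨ mulVec-*ˡ (- sign bip u) f u ⟩
    - sign bip u * mulVec A f u            ≡⟨ cong (- sign bip u *_) (eig u) ⟩
    - sign bip u * (μ * f u)               ≡⟨ solve 3 (λ s m x → (:- s) :* (m :* x) := (:- m) :* (s :* x))
                                                refl (sign bip u) μ (f u) ⟩
    - μ * (sign bip u * f u)               ∎
    where open ≡-Reasoning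

  eigen-−degree-sign : ∀ {d f} → Connected A → (bip : Bipartite A) → Regular d A →
                       Eigen A (- fromℕ d) f → ∀ u v → f v ≡ (sign bip u * f u) * sign bip v
  eigen-−degree-sign {d} {f} conn bip reg eig u v = begin
    f v                                ≡⟨ sym (ℚₚ.*-identityˡ (f v)) ⟩
    1ℚ * f v                           ≡⟨ cong (_* f v) (sym (sign*sign bip v)) ⟩
    (sign bip v * sign bip v) * f v    ≡⟨ ℚₚ.*-assoc (sign bip v) (sign bip v) (f v) ⟩
    sign bip v * (sign bip v * f v)    ≡⟨ cong (sign bip v *_) (eigen-degree-constant conn reg flipped v u) ⟩
    sign bip v * (sign bip u * f u)    ≡⟨ ℚₚ.*-comm (sign bip v) _ ⟩
    (sign bip u * f u) * sign bip v    ∎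
    where
    open ≡-Reasoning
    flipped : Eigen A (fromℕ d) (λ w → sign bip w * f w)
    flipped = subst (λ μ → Eigen A μ (λ w → sign bip w * f w)) (⁻¹-involutive (fromℕ d))
                    (sign-flip {μ = - fromℕ d} bip eig)

encode : ∀ {n p} → M5Vert n p → Fin (n ℕ.+ n ℕ.* (p ℕ.* 4))
encode {n} {p} (old v)     = v ↑ˡ (n ℕ.* (p ℕ.* 4))
encode {n}     (new v c k) = n ↑ʳ combine v (combine c k)

decode-encode : ∀ {n p} (w : M5Vert n p) → decode n p (encode w) ≡ w
decode-encode {n} {p} (old v) rewrite Finₚ.splitAt-↑ˡ n v (n ℕ.* (p ℕ.* 4)) = refl
decode-encode {n} {p} (new v c k)
  rewrite Finₚ.splitAt-↑ʳ n (n ℕ.* (p ℕ.* 4)) (combine v (combine c k)) =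
  trans (cong (λ (u , r) → uncurry (new u) (remQuot {p} 4 r))
              (Finₚ.remQuot-combine {n} {p ℕ.* 4} v (combine c k)))
        (cong (uncurry (new v)) (Finₚ.remQuot-combine {p} {4} c k))

encode-decode : ∀ n p (i : Fin (n ℕ.+ n ℕ.* (p ℕ.* 4))) → encode (decode n p i) ≡ i
encode-decode n p i with splitAt n i in split≡
... | inj₁ v = trans (cong (Fin.join n _) (sym split≡)) (Finₚ.join-splitAt n _ i)
... | inj₂ w = trans (cong (n ↑ʳ_) combine-remQuot²)
                     (trans (cong (Fin.join n _) (sym split≡)) (Finₚ.join-splitAt n _ i))
  where
  v : Fin n
  v = proj₁ (remQuot {n} (p ℕ.* 4) w)
  r : Fin (p ℕ.* 4)
  r = proj₂ (remQuot {n} (p ℕ.* 4) w)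
  combine-remQuot² : combine v (uncurry combine (remQuot {p} 4 r)) ≡ w
  combine-remQuot² = trans (cong (combine v) (Finₚ.combine-remQuot {p} 4 r)) (Finₚ.combine-remQuot {n} (p ℕ.* 4) w)

ΣV : ∀ n p → (M5Vert n p → ℚ) → ℚ
ΣV n p F = Σℚ n (F ∘ old) + Σℚ n (λ v → Σℚ p (λ c → Σℚ 4 (F ∘ new v c)))

ΣV-cong : ∀ {n p} {F G : M5Vert n p → ℚ} → (∀ w → F w ≡ G w) → ΣV n p F ≡ ΣV n p G
ΣV-cong {n} {p} F≡G =
  cong₂ _+_ (Σℚ-cong n (F≡G ∘ old)) (Σℚ-cong n (λ v → Σℚ-cong p (λ c → Σℚ-cong 4 (F≡G ∘ new v c))))

Σℚ-encode : ∀ n p (f : Fin (n ℕ.+ n ℕ.* (p ℕ.* 4)) → ℚ) → Σℚ (n ℕ.+ n ℕ.* (p ℕ.* 4)) f ≡ ΣV n p (f ∘ encode)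
Σℚ-encode n p f = trans (Σℚ-↑ n (n ℕ.* (p ℕ.* 4)) f)
  (cong (Σℚ n (λ v → f (encode {n} {p} (old v))) +_)
    (trans (Σℚ-combine n (p ℕ.* 4) _) (Σℚ-cong n (λ v → Σℚ-combine p 4 _))))

pathAdj : Fin 4 → Fin 4 → Bool
pathAdj k k′ = eqN (suc (toℕ k)) (toℕ k′) ∨ eqN (suc (toℕ k′)) (toℕ k)

pentagon⁻ pentagon⁺ : ∀ {n p} → Fin n → Fin p → Fin 4 → M5Vert n p
pentagon⁻ v c 0F = old v
pentagon⁻ v c 1F = new v c 0F
pentagon⁻ v c 2F = new v c 1F
pentagon⁻ v c 3F = new v c 2F
pentagon⁺ v c 0F = new v c 1F
pentagon⁺ v c 1F = new v c 2F
pentagon⁺ v c 2F = new v c 3F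
pentagon⁺ v c 3F = old v

extend : ∀ {n p} → (Fin n → ℚ) → M5Vert n p → ℚ
extend f (old v)     = f v
extend f (new v c k) = if isEnd k then f v else - f v

extend-multiple : ∀ {n p f g} t → (∀ v → f v ≡ t * g v) → (w : M5Vert n p) → extend f w ≡ t * extend g w
extend-multiple t f≡tg (old v)      = f≡tg v
extend-multiple {g = g} t f≡tg (new v c k) with isEnd k
... | true  = f≡tg v
... | false = trans (cong -_ (f≡tg v)) (ℚₚ.neg-distribʳ-* t (g v))

extend-≢0 : ∀ {n p f} → (∀ v → f v ≢ 0ℚ) → (w : M5Vert n p) → extend f w ≢ 0ℚ
extend-≢0 f≢0 (old v)      = f≢0 v
extend-≢0 f≢0 (new v c k) with isEnd k
... | true  = f≢0 v
... | false = f≢0 v ∘ ℚₚ.neg-injective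

module _ {n p : ℕ} (A : AdjMat n) where

  mulVecV : (M5Vert n p → ℚ) → M5Vert n p → ℚ
  mulVecV X w = ΣV n p (λ w′ → if adjV A w w′ then X w′ else 0ℚ)

  mulVecV-cong : ∀ {X Y} → (∀ w → X w ≡ Y w) → ∀ w → mulVecV X w ≡ mulVecV Y w
  mulVecV-cong X≡Y w = ΣV-cong (λ w′ → cong (λ x → if adjV A w w′ then x else 0ℚ) (X≡Y w′))

  mulVec-M5 : ∀ x w → mulVec (M5 p A) x (encode w) ≡ mulVecV (x ∘ encode) w
  mulVec-M5 x w = trans (Σℚ-encode n p _) (ΣV-cong adjacency)
    where
    adjacency : ∀ w′ → (if adjV A (decode n p (encode w)) (decode n p (encode w′)) then x (encode w′) else 0ℚ)
                     ≡ (if adjV A w w′ then x (encode w′) else 0ℚ)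
    adjacency w′ rewrite decode-encode w | decode-encode w′ = refl

  mulVecV-old : ∀ X v → mulVecV X (old v) ≡
    mulVec A (X ∘ old) v + Σℚ p (λ c → Σℚ 4 (λ k → if isEnd k then X (new v c k) else 0ℚ))
  mulVecV-old X v = cong (mulVec A (X ∘ old) v +_)
    (trans (Σℚ-cong n (λ v′ → Σℚ²-if-∧ p 4 (eqF v v′) (λ _ → isEnd) (λ c → X ∘ new v′ c))) (Σℚ-δ n v _))

  mulVecV-new : ∀ X v c k → mulVecV X (new v c k) ≡ X (pentagon⁻ v c k) + X (pentagon⁺ v c k)
  mulVecV-new X v c k = trans (cong₂ _+_ to-old to-new) (on-pentagon k)
    where
    to-old : Σℚ n (λ u → if eqF u v ∧ isEnd k then X (old u) else 0ℚ) ≡ (if isEnd k then X (old v) else 0ℚ)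
    to-old = trans (Σℚ-cong n (λ u → trans (cong (λ e → if e ∧ isEnd k then X (old u) else 0ℚ) (eqF-sym u v))
                                            (if-∧ (eqF v u) (isEnd k) (X (old u)))))
                   (Σℚ-δ n v _)
    to-new : Σℚ n (λ v′ → Σℚ p (λ c′ → Σℚ 4 (λ k′ →
               if eqF v v′ ∧ eqF c c′ ∧ pathAdj k k′ then X (new v′ c′ k′) else 0ℚ)))
           ≡ Σℚ 4 (λ k′ → if pathAdj k k′ then X (new v c k′) else 0ℚ)
    to-new = trans (Σℚ-cong n (λ v′ →
                      Σℚ²-if-∧ p 4 (eqF v v′) (λ c′ k′ → eqF c c′ ∧ pathAdj k k′) (λ c′ → X ∘ new v′ c′)))
            (trans (Σℚ-δ n v _)
            (trans (Σℚ-cong p (λ c′ → Σℚ-if-∧ 4 (eqF c c′) (pathAdj k) (X ∘ new v c′)))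
                   (Σℚ-δ p c _)))
    on-pentagon : ∀ k →
      (if isEnd k then X (old v) else 0ℚ) + Σℚ 4 (λ k′ → if pathAdj k k′ then X (new v c k′) else 0ℚ)
        ≡ X (pentagon⁻ v c k) + X (pentagon⁺ v c k)
    on-pentagon 0F = solve 2 (λ a b → a :+ (con 0ℚ :+ (b :+ (con 0ℚ :+ (con 0ℚ :+ con 0ℚ)))) := a :+ b)
                       refl (X (old v)) (X (new v c 1F))
    on-pentagon 1F = solve 2 (λ a b → con 0ℚ :+ (a :+ (con 0ℚ :+ (b :+ (con 0ℚ :+ con 0ℚ)))) := a :+ b)
                       refl (X (new v c 0F)) (X (new v c 2F))
    on-pentagon 2F = solve 2 (λ a b → con 0ℚ :+ (con 0ℚ :+ (a :+ (con 0ℚ :+ (b :+ con 0ℚ)))) := a :+ b)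
                       refl (X (new v c 1F)) (X (new v c 3F))
    on-pentagon 3F = solve 2 (λ a b → b :+ (con 0ℚ :+ (con 0ℚ :+ (a :+ (con 0ℚ :+ con 0ℚ)))) := a :+ b)
                       refl (X (new v c 2F)) (X (old v))

  mulVecV-extend-old : ∀ f v → mulVecV (extend f) (old v) ≡ mulVec A f v + fromℕ (2 ℕ.* p) * f v
  mulVecV-extend-old f v = trans (mulVecV-old (extend f) v) (cong (mulVec A f v +_) (begin
    Σℚ p (λ c → Σℚ 4 (λ k → if isEnd k then extend f (new v c k) else 0ℚ))
      ≡⟨ Σℚ-cong p (λ _ → solve 1 (λ x → x :+ (con 0ℚ :+ (con 0ℚ :+ (x :+ con 0ℚ))) := x :+ x) refl (f v)) ⟩
    Σℚ p (λ _ → f v + f v)            ≡⟨ Σℚ-const p (f v + f v) ⟩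
    fromℕ p * (f v + f v)             ≡⟨ solve 2 (λ a x → a :* (x :+ x) := (a :+ a) :* x) refl (fromℕ p) (f v) ⟩
    (fromℕ p + fromℕ p) * f v         ≡⟨ cong (_* f v) (sym (fromℕ-double p)) ⟩
    fromℕ (2 ℕ.* p) * f v             ∎))
    where open ≡-Reasoning

  mulVecV-extend-new : ∀ f v c k → mulVecV (extend f) (new v c k) ≡ 0ℚ
  mulVecV-extend-new f v c k = trans (mulVecV-new (extend f) v c k) (alternating k)
    where
    alternating : ∀ k → extend f (pentagon⁻ v c k) + extend f (pentagon⁺ v c k) ≡ 0ℚ
    alternating 0F = ℚₚ.+-inverseʳ (f v)
    alternating 1F = ℚₚ.+-inverseʳ (f v)
    alternating 2F = ℚₚ.+-inverseˡ (f v)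
    alternating 3F = ℚₚ.+-inverseˡ (f v)

  extend-mulVecV≡0 : ∀ {f} → Eigen A (- fromℕ (2 ℕ.* p)) f → ∀ w → mulVecV (extend f) w ≡ 0ℚ
  extend-mulVecV≡0 {f} eig (old v) = begin
    mulVecV (extend f) (old v)               ≡⟨ mulVecV-extend-old f v ⟩
    mulVec A f v + D * f v                   ≡⟨ cong (_+ D * f v) (eig v) ⟩
    - D * f v + D * f v                      ≡⟨ cong (_+ D * f v) (sym (ℚₚ.neg-distribˡ-* D (f v))) ⟩
    - (D * f v) + D * f v                    ≡⟨ ℚₚ.+-inverseˡ (D * f v) ⟩
    0ℚ                                       ∎
    where
    open ≡-Reasoning
    D : ℚ
    D = fromℕ (2 ℕ.* p)
  extend-mulVecV≡0 {f} _ (new v c k) = mulVecV-extend-new f v c k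

  mulVecV≡0⇒extend : ∀ Y → (∀ w → mulVecV Y w ≡ 0ℚ) →
                    (∀ w → Y w ≡ extend (Y ∘ old) w) × Eigen A (- fromℕ (2 ℕ.* p)) (Y ∘ old)
  mulVecV≡0⇒extend Y ker = Y≡extend , eigen
    where
    edge : ∀ v c k → Y (pentagon⁻ v c k) + Y (pentagon⁺ v c k) ≡ 0ℚ
    edge v c k = trans (sym (mulVecV-new Y v c k)) (ker (new v c k))
    Y₁≡ : ∀ v c → Y (new v c 1F) ≡ - Y (old v)
    Y₁≡ v c = inverseʳ-unique _ _ (edge v c 0F)
    Y₂≡ : ∀ v c → Y (new v c 2F) ≡ - Y (old v)
    Y₂≡ v c = inverseˡ-unique _ _ (edge v c 3F)
    Y≡extend : ∀ w → Y w ≡ extend (Y ∘ old) w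
    Y≡extend (old v)      = refl
    Y≡extend (new v c 0F) = trans (inverseˡ-unique _ _ (edge v c 1F)) (trans (cong -_ (Y₂≡ v c)) (⁻¹-involutive _))
    Y≡extend (new v c 1F) = Y₁≡ v c
    Y≡extend (new v c 2F) = Y₂≡ v c
    Y≡extend (new v c 3F) = trans (inverseʳ-unique _ _ (edge v c 2F)) (trans (cong -_ (Y₁≡ v c)) (⁻¹-involutive _))
    eigen : Eigen A (- fromℕ (2 ℕ.* p)) (Y ∘ old)
    eigen v = trans (inverseˡ-unique _ _ kernel-at-v) (ℚₚ.neg-distribˡ-* (fromℕ (2 ℕ.* p)) (Y (old v)))
      where
      kernel-at-v : mulVec A (Y ∘ old) v + fromℕ (2 ℕ.* p) * Y (old v) ≡ 0ℚ
      kernel-at-v = trans (sym (mulVecV-extend-old (Y ∘ old) v))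
                          (trans (sym (mulVecV-cong Y≡extend (old v))) (ker (old v)))

  mulVecV≡0⇒inKernel : ∀ X → (∀ w → mulVecV X w ≡ 0ℚ) → InKernel (M5 p A) (X ∘ decode n p)
  mulVecV≡0⇒inKernel X ker i = subst (λ j → mulVec (M5 p A) (X ∘ decode n p) j ≡ 0ℚ) (encode-decode n p i)
    (trans (mulVec-M5 (X ∘ decode n p) (decode n p i))
      (trans (mulVecV-cong (cong X ∘ decode-encode) (decode n p i)) (ker (decode n p i))))

  inKernel⇒mulVecV≡0 : ∀ {y} → InKernel (M5 p A) y → ∀ w → mulVecV (y ∘ encode) w ≡ 0ℚ
  inKernel⇒mulVecV≡0 {y} ker w = trans (sym (mulVec-M5 y w)) (ker (encode w))

  M5-kernel-spanned : ∀ {y} → Connected A → (bip : Bipartite A) → Regular (2 ℕ.* p) A →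
                      InKernel (M5 p A) y → Σ ℚ λ t → ∀ i → y i ≡ t * extend (sign bip) (decode n p i)
  M5-kernel-spanned {y} conn bip reg ker = sign bip v₀ * f v₀ , λ i → begin
    y i                        ≡⟨ cong y (sym (encode-decode n p i)) ⟩
    y (encode (decode n p i))  ≡⟨ y≡extend (decode n p i) ⟩
    extend f (decode n p i)    ≡⟨ extend-multiple {g = sign bip} (sign bip v₀ * f v₀)
                                    (eigen-−degree-sign conn bip reg eig v₀) (decode n p i) ⟩
    sign bip v₀ * f v₀ * extend (sign bip) (decode n p i) ∎
    where
    open ≡-Reasoning
    v₀ : Fin n
    v₀ = Fin.fromℕ< (proj₁ conn)
    f : Fin n → ℚ
    f v = y (encode {n} {p} (old v))
    y≡extend : ∀ w → y (encode w) ≡ extend f w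
    y≡extend = proj₁ (mulVecV≡0⇒extend (y ∘ encode) (inKernel⇒mulVecV≡0 ker))
    eig : Eigen A (- fromℕ (2 ℕ.* p)) f
    eig = proj₂ (mulVecV≡0⇒extend (y ∘ encode) (inKernel⇒mulVecV≡0 ker))

  M5-simple : Simple A → Simple (M5 p A)
  M5-simple (sym-A , loopless) = (λ i j → adjV-sym (decode n p i) (decode n p j)) , adjV-irrefl ∘ decode n p
    where
    adjV-sym : ∀ w w′ → adjV A w w′ ≡ adjV A w′ w
    adjV-sym (old u)     (old v)        = sym-A u v
    adjV-sym (old _)     (new _ _ _)    = refl
    adjV-sym (new _ _ _) (old _)        = refl
    adjV-sym (new v c k) (new v′ c′ k′)
      rewrite eqF-sym v v′ | eqF-sym c c′ | ∨-comm (eqN (suc (toℕ k)) (toℕ k′)) (eqN (suc (toℕ k′)) (toℕ k)) = refl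
    adjV-irrefl : ∀ w → adjV A w w ≡ false
    adjV-irrefl (old u)     = loopless u
    adjV-irrefl (new v c k) rewrite eqF-refl v | eqF-refl c | eqN-suc (toℕ k) = refl

  M5-edge : ∀ w w′ → T (adjV A w w′) → T (M5 p A (encode w) (encode w′))
  M5-edge w w′ = subst T (sym (cong₂ (adjV A) (decode-encode w) (decode-encode w′)))

  liftʷ : ∀ {u v} → Walk A u v → Walk (M5 p A) (encode {n} {p} (old u)) (encode {n} {p} (old v))
  liftʷ here       = here
  liftʷ (step {u} {v} e w) = step (M5-edge (old u) (old v) e) (liftʷ w)

  end-edge : ∀ v (c : Fin p) k → T (isEnd k) → T (adjV A (new v c k) (old v))
  end-edge v _ _ end = Equivalence.from T-∧ (T-eqF-refl v , end)

  path-edge : ∀ v (c : Fin p) k k′ → T (pathAdj k k′) → T (adjV A (new v c k) (new v c k′))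
  path-edge v c _ _ adj = Equivalence.from T-∧ (T-eqF-refl v , Equivalence.from T-∧ (T-eqF-refl c , adj))

  root : M5Vert n p → Fin n
  root (old v)     = v
  root (new v _ _) = v

  toRoot : ∀ w → Walk (M5 p A) (encode w) (encode {n} {p} (old (root w)))
  toRoot (old v)      = here
  toRoot (new v c 0F) = step (M5-edge (new v c 0F) (old v) (end-edge v c 0F tt)) here
  toRoot (new v c 1F) = step (M5-edge (new v c 1F) (new v c 0F) (path-edge v c 1F 0F tt)) (toRoot (new v c 0F))
  toRoot (new v c 2F) = step (M5-edge (new v c 2F) (new v c 3F) (path-edge v c 2F 3F tt)) (toRoot (new v c 3F))
  toRoot (new v c 3F) = step (M5-edge (new v c 3F) (old v) (end-edge v c 3F tt)) here

  M5-connected : Simple A → Connected A → Connected (M5 p A)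
  M5-connected simple (n>0 , walk) = ℕₚ.<-≤-trans n>0 (ℕₚ.m≤m+n n _) , λ i j →
    subst₂ (Walk (M5 p A)) (encode-decode n p i) (encode-decode n p j)
      (toRoot (decode n p i) ++ʷ
       liftʷ (walk (root (decode n p i)) (root (decode n p j))) ++ʷ
       reverseʷ (proj₁ (M5-simple simple)) (toRoot (decode n p j)))

proposition17 : (p : ℕ) → 1 ℕ.≤ p → (n : ℕ) → (A : AdjMat n) →
    Simple A → Connected A → Bipartite A → Regular (2 ℕ.* p) A →
    IsNut (M5 p A)
proposition17 p _ n A simple conn bip reg =
  M5-simple A simple ,
  M5-connected A simple conn ,
  extend (sign bip) ∘ decode n p ,
  mulVecV≡0⇒inKernel A (extend (sign bip)) (extend-mulVecV≡0 A (sign-eigen bip reg)) ,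
  extend-≢0 (sign≢0 bip) ∘ decode n p ,
  λ _ → M5-kernel-spanned A conn bip reg
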